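{- For each $n\ge 1$, there are exactly $3^{n-1}$ tortoise pop-stack sortable Cayley permutations of length $n$.
   Context: A Cayley permutation is a finite word $\pi=\pi_1\cdots\pi_n$ over the positive integers such that every integer from $1$ to $\max(\pi)$ occurs at least once. A tortoise pop-stack processes an input from left to right with a right-greedy algorithm: while the input is nonempty, the next input element is pushed if the resulting stack contents, read from top to bottom, are strictly increasing from top to bottom (i.e. avoid the patterns $21$ and $11$); otherwise a pop operation is performed, which removes all elements of the stack, appending them to the output in order from top to bottom. When the input is exhausted, the stack is emptied in the same way. $\pi$ is tortoise pop-stack sortable if the output on input $\pi$ is weakly increasing. -}

module Defs where

open import Data.Nat using (ℕ; zero; suc; _≤_; _<_; _⊔_; _<?_)
open import Data.List using (List; []; _∷_; _++_; foldr)
open import Data.List.Relation.Unary.All using (All)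
open import Data.List.Relation.Unary.Linked using (Linked)
open import Data.List.Membership.Propositional using (_∈_)
open import Data.Product using (_×_)
open import Relation.Nullary using (yes; no)

maxW : List ℕ → ℕ
maxW = foldr _⊔_ 0

IsCayley : List ℕ → Set
IsCayley w = All (1 ≤_) w × (∀ k → 1 ≤ k → k ≤ maxW w → k ∈ w)

-- The stack is a list whose head is the top.
-- Pushing x onto a nonempty stack with top t keeps the stack strictly
-- increasing from top to bottom iff x < t.  A pop outputs the whole
-- stack from top to bottom and empties it; after a pop the stack is
-- empty, so the next input element is pushed immediately.
tortoiseRun : List ℕ → List ℕ → List ℕ
tortoiseRun s [] = s
tortoiseRun [] (x ∷ xs) = tortoiseRun (x ∷ []) xs
tortoiseRun (t ∷ s) (x ∷ xs) with x <? t
... | yes _ = tortoiseRun (x ∷ t ∷ s) xs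
... | no _ = (t ∷ s) ++ tortoiseRun (x ∷ []) xs

tortoise : List ℕ → List ℕ
tortoise = tortoiseRun []

WeaklyIncreasing : List ℕ → Set
WeaklyIncreasing = Linked _≤_

TortoiseSortable : List ℕ → Set
TortoiseSortable w = WeaklyIncreasing (tortoise w)

-- The tortoise pops exactly at the end of each maximal strictly decreasing
-- factor of its input and outputs that factor reversed, so a word is
-- sortable iff the largest entry of each factor is at most the least entry
-- of the next one.  For a Cayley permutation this forces every factor to be
-- a run b, b - 1, …, a of consecutive values, the first one ending at a = 1
-- and each later one ending at the top b of its predecessor or at b + 1.
-- Recording, for each of the n - 1 gaps between adjacent letters, whether it
-- lies inside a factor or starts a factor of either kind is a bijection onto
-- the words of length n - 1 over a three-letter alphabet.
module Submission where

open import Defs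
open import Data.Nat using (ℕ; suc; _^_)
open import Data.List using (List; length)
open import Data.List.Relation.Unary.Unique.Propositional using (Unique)
open import Data.List.Membership.Propositional using (_∈_)
open import Data.Product using (Σ; _×_)
open import Function.Bundles using (_⇔_)
open import Relation.Binary.PropositionalEquality using (_≡_)

open import Data.Nat using (zero; _+_; _*_; _∸_; _≤_; _<_; _>_; _<?_; _≟_; s≤s)
open import Data.Nat.Properties
  using ( ≤-refl; ≤-trans; ≤-antisym; <-trans; <⇒≤; ≤-pred; ≤⇒≯; <⇒≱; ≮⇒≥; ≤∧≢⇒<
        ; n≤1+n; m≤n⇒m≤1+n; m≤n+m; m≤n⇒m<n∨m≡n; 1+n≰n; 1+n≢n; n≮n
        ; +-suc; +-identityʳ; +-cancelˡ-≡; m∸n+n≡m; suc-injective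
        ; ⊔-sel; m⊔n≤o⇒m≤o; m⊔n≤o⇒n≤o )
open import Data.Nat.Induction using (<-wellFounded)
open import Data.Maybe using (just)
open import Data.Maybe.Properties using (just-injective)
open import Data.Maybe.Relation.Binary.Connected using (Connected; just; just-nothing; nothing-just; drop-just)
open import Data.List
  using ( []; _∷_; _++_; [_]; _∷ʳ_; _ʳ++_; map; replicate; head; last; reverse
        ; applyUpTo; applyDownFrom; cartesianProductWith )
open import Data.List.Properties
  using ( length-++; length-map; length-++-≤ʳ; length-applyDownFrom; ++-identityʳ; ++-cancelˡ
        ; ∷-injective; unfold-reverse; applyUpTo-∷ʳ; foldr-forcesᵇ )
open import Data.List.Membership.Propositional.Properties
  using ( ∈-++⁺ˡ; ∈-++⁺ʳ; ∈-++⁻; ∈-map⁺; ∈-map⁻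
        ; ∈-cartesianProductWith⁺; ∈-cartesianProductWith⁻; foldr-selective )
open import Data.List.Membership.DecPropositional _≟_ using (_∈?_)
open import Data.List.Relation.Binary.Subset.Propositional using (_⊆_)
open import Data.List.Relation.Binary.Permutation.Propositional using (_↭_; ↭-sym; ↭-trans; ↭-reflexive)
open import Data.List.Relation.Binary.Permutation.Propositional.Properties using (shift; ++⁺ˡ; ∈-resp-↭)
open import Data.List.Relation.Unary.Any using (here; there)
open import Data.List.Relation.Unary.Any.Properties using (reverseAcc⁺)
open import Data.List.Relation.Unary.All using (All; []; _∷_)
import Data.List.Relation.Unary.All as All
import Data.List.Relation.Unary.All.Properties as All
open import Data.List.Relation.Unary.AllPairs using (AllPairs; []; _∷_)
open import Data.List.Relation.Unary.Linked using (Linked; []; [-]; _∷_; head′)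
import Data.List.Relation.Unary.Linked as Linked
import Data.List.Relation.Unary.Linked.Properties as Linked
open import Data.List.Relation.Unary.Unique.Propositional.Properties using (map⁺; cartesianProductWith⁺)
open import Data.Product using (_,_; ∃; ∃₂; proj₁; proj₂; map₂; uncurry)
open import Data.Sum using (_⊎_; inj₁; inj₂; [_,_]′)
open import Function using (_∘_)
open import Induction.WellFounded using (WellFounded; Acc; acc)
import Relation.Binary.Construct.On as On
open import Relation.Nullary using (yes; no; contradiction)
open import Relation.Binary.PropositionalEquality using (_≢_; refl; sym; trans; cong; cong₂; subst; subst₂; module ≡-Reasoning)
open import Function.Bundles using (mk⇔)

open ≡-Reasoning

length-cartesianProductWith : ∀ {A B C : Set} (f : A → B → C) xs ys →
  length (cartesianProductWith f xs ys) ≡ length xs * length ys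
length-cartesianProductWith f [] ys = refl
length-cartesianProductWith f (x ∷ xs) ys = begin
  length (map (f x) ys ++ cartesianProductWith f xs ys)
    ≡⟨ length-++ (map (f x) ys) ⟩
  length (map (f x) ys) + length (cartesianProductWith f xs ys)
    ≡⟨ cong₂ _+_ (length-map (f x) ys) (length-cartesianProductWith f xs ys) ⟩
  length ys + length xs * length ys
    ∎

reverse-applyDownFrom : ∀ {A : Set} (f : ℕ → A) n → reverse (applyDownFrom f n) ≡ applyUpTo f n
reverse-applyDownFrom f zero = refl
reverse-applyDownFrom f (suc n) = begin
  reverse (f n ∷ applyDownFrom f n)   ≡⟨ unfold-reverse (f n) (applyDownFrom f n) ⟩
  reverse (applyDownFrom f n) ∷ʳ f n  ≡⟨ cong (_∷ʳ f n) (reverse-applyDownFrom f n) ⟩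
  applyUpTo f n ∷ʳ f n                ≡⟨ applyUpTo-∷ʳ f n ⟩
  applyUpTo f (suc n)                 ∎

last-applyUpTo : ∀ {A : Set} (f : ℕ → A) n → last (applyUpTo f (suc n)) ≡ just (f n)
last-applyUpTo f zero = refl
last-applyUpTo f (suc n) = last-applyUpTo (f ∘ suc) n

linked-++⁻ʳ : ∀ {A : Set} {R : A → A → Set} xs {ys} → Linked R (xs ++ ys) → Linked R ys
linked-++⁻ʳ [] l = l
linked-++⁻ʳ (x ∷ xs) l = linked-++⁻ʳ xs (Linked.tail l)

allPairs-++⁻ : ∀ {A : Set} {R : A → A → Set} xs {ys x y} →
  AllPairs R (xs ++ ys) → x ∈ xs → y ∈ ys → R x y
allPairs-++⁻ (x ∷ xs) (x~ ∷ _) (here refl) y∈ = All.lookup x~ (∈-++⁺ʳ xs y∈)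
allPairs-++⁻ (x ∷ xs) (_ ∷ p) (there x∈) y∈ = allPairs-++⁻ xs p x∈ y∈

StrictlyDecreasing : List ℕ → Set
StrictlyDecreasing = Linked _>_

decreasing-< : ∀ {x xs y} → StrictlyDecreasing (x ∷ xs) → y ∈ xs → y < x
decreasing-< (x>y ∷ _) (here refl) = x>y
decreasing-< (x>x′ ∷ d) (there y∈) = <-trans (decreasing-< d y∈) x>x′

decreasing-≤ : ∀ {x xs y} → StrictlyDecreasing (x ∷ xs) → y ∈ x ∷ xs → y ≤ x
decreasing-≤ d (here refl) = ≤-refl
decreasing-≤ d (there y∈) = <⇒≤ (decreasing-< d y∈)

decreasing-unique : ∀ xs ys → StrictlyDecreasing xs → StrictlyDecreasing ys → xs ⊆ ys → ys ⊆ xs → xs ≡ ys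
decreasing-unique [] [] _ _ _ _ = refl
decreasing-unique [] (y ∷ ys) _ _ _ ys⊆xs with ys⊆xs (here refl)
... | ()
decreasing-unique (x ∷ xs) [] _ _ xs⊆ys _ with xs⊆ys (here refl)
... | ()
decreasing-unique (x ∷ xs) (y ∷ ys) dx dy xs⊆ys ys⊆xs =
  cong₂ _∷_ x≡y (decreasing-unique xs ys (Linked.tail dx) (Linked.tail dy)
                  (tail-⊆ dx x≡y xs⊆ys) (tail-⊆ dy (sym x≡y) ys⊆xs))
  where
  x≡y : x ≡ y
  x≡y = ≤-antisym (decreasing-≤ dy (xs⊆ys (here refl))) (decreasing-≤ dx (ys⊆xs (here refl)))
  tail-⊆ : ∀ {a as b bs} → StrictlyDecreasing (a ∷ as) → a ≡ b → a ∷ as ⊆ b ∷ bs → as ⊆ bs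
  tail-⊆ da refl sub z∈ with sub (there z∈)
  ... | here refl = contradiction (decreasing-< da z∈) (n≮n _)
  ... | there z∈bs = z∈bs

≤-maxW : ∀ w → All (_≤ maxW w) w
≤-maxW w = foldr-forcesᵇ (λ x y x⊔y≤ → m⊔n≤o⇒m≤o x y x⊔y≤ , m⊔n≤o⇒n≤o x y x⊔y≤) 0 w ≤-refl

maxW-∈ : ∀ w → 1 ≤ maxW w → maxW w ∈ w
maxW-∈ w 1≤max with foldr-selective ⊔-sel 0 w
... | inj₁ max≡0 = contradiction (subst (1 ≤_) max≡0 1≤max) λ ()
... | inj₂ max∈w = max∈w

tortoiseRun-pushAll : ∀ {s} xs rest → StrictlyDecreasing xs → Connected _>_ (head s) (head xs) →
  tortoiseRun s (xs ++ rest) ≡ tortoiseRun (xs ʳ++ s) rest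
tortoiseRun-pushAll [] rest _ _ = refl
tortoiseRun-pushAll {[]} (x ∷ xs) rest dx _ = tortoiseRun-pushAll xs rest (Linked.tail dx) (head′ dx)
tortoiseRun-pushAll {t ∷ s} (x ∷ xs) rest dx (just t>x) with x <? t
... | yes _ = tortoiseRun-pushAll xs rest (Linked.tail dx) (head′ dx)
... | no t≯x = contradiction t>x t≯x

tortoiseRun-pop : ∀ s rest → Connected _≤_ (head s) (head rest) → tortoiseRun s rest ≡ s ++ tortoise rest
tortoiseRun-pop s [] _ = sym (++-identityʳ s)
tortoiseRun-pop [] (x ∷ xs) _ = refl
tortoiseRun-pop (t ∷ s) (x ∷ xs) (just t≤x) with x <? t
... | yes x<t = contradiction x<t (≤⇒≯ t≤x)
... | no _ = refl

tortoiseRun-firstPop : ∀ t s w → ∃₂ λ b rest →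
  w ≡ b ++ rest × StrictlyDecreasing (t ∷ b) × tortoiseRun (t ∷ s) w ≡ (b ʳ++ t ∷ s) ++ tortoise rest
tortoiseRun-firstPop t s [] = [] , [] , refl , [-] , sym (++-identityʳ (t ∷ s))
tortoiseRun-firstPop t s (x ∷ xs) with x <? t
... | no _ = [] , x ∷ xs , refl , [-] , refl
... | yes x<t with b , rest , refl , dx , run ← tortoiseRun-firstPop x (t ∷ s) xs =
  x ∷ b , rest , refl , x<t ∷ dx , run

tortoiseRun-↭ : ∀ s w → tortoiseRun s w ↭ s ++ w
tortoiseRun-↭ s [] = ↭-reflexive (sym (++-identityʳ s))
tortoiseRun-↭ [] (x ∷ xs) = tortoiseRun-↭ [ x ] xs
tortoiseRun-↭ (t ∷ s) (x ∷ xs) with x <? t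
... | yes _ = ↭-trans (tortoiseRun-↭ (x ∷ t ∷ s) xs) (↭-sym (shift x (t ∷ s) xs))
... | no _ = ++⁺ˡ (t ∷ s) (tortoiseRun-↭ [ x ] xs)

descent : ℕ → ℕ → List ℕ
descent u k = applyDownFrom (_+ u) (suc k)

ascent : ℕ → ℕ → List ℕ
ascent u k = applyUpTo (_+ u) (suc k)

descent-decreasing : ∀ u k → StrictlyDecreasing (descent u k)
descent-decreasing u k = Linked.applyDownFrom⁺₂ (_+ u) (suc k) (λ _ → ≤-refl)

ascent-sorted : ∀ u k → WeaklyIncreasing (ascent u k)
ascent-sorted u k = Linked.applyUpTo⁺₂ (_+ u) (suc k) (λ i → n≤1+n (i + u))

∈-descent⁺ : ∀ {u k j} → u ≤ j → j ≤ k + u → j ∈ descent u k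
∈-descent⁺ {k = zero} u≤j j≤u = here (≤-antisym j≤u u≤j)
∈-descent⁺ {k = suc k} u≤j j≤top with m≤n⇒m<n∨m≡n j≤top
... | inj₁ j<top = there (∈-descent⁺ u≤j (≤-pred j<top))
... | inj₂ j≡top = here j≡top

∈-descent⁻ : ∀ {u k j} → j ∈ descent u k → u ≤ j × j ≤ k + u
∈-descent⁻ {u} {k} (here refl) = m≤n+m u k , ≤-refl
∈-descent⁻ {k = zero} (there ())
∈-descent⁻ {k = suc k} (there j∈) = map₂ m≤n⇒m≤1+n (∈-descent⁻ j∈)

tortoise-descent : ∀ u k rest → All (u ≤_) rest → tortoise (descent u k ++ rest) ≡ ascent u k ++ tortoise rest
tortoise-descent u k rest u≤rest = begin
  tortoiseRun [] (descent u k ++ rest)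
    ≡⟨ tortoiseRun-pushAll (descent u k) rest (descent-decreasing u k) nothing-just ⟩
  tortoiseRun (reverse (descent u k)) rest
    ≡⟨ cong (λ s → tortoiseRun s rest) (reverse-applyDownFrom (_+ u) (suc k)) ⟩
  tortoiseRun (ascent u k) rest
    ≡⟨ tortoiseRun-pop (ascent u k) rest (u≤head u≤rest) ⟩
  ascent u k ++ tortoise rest
    ∎
  where
  u≤head : ∀ {w} → All (u ≤_) w → Connected _≤_ (just u) (head w)
  u≤head [] = just-nothing
  u≤head (u≤x ∷ _) = just u≤x

record IntervalFrom (u : ℕ) (w : List ℕ) : Set where
  field
    lower  : All (u ≤_) w
    bottom : u ∈ w
    closed : ∀ {j y} → u ≤ j → j ≤ y → y ∈ w → j ∈ w
open IntervalFrom

descent-interval : ∀ u k → IntervalFrom u (descent u k)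
descent-interval u k = record
  { lower  = All.tabulate (λ j∈ → proj₁ (∈-descent⁻ j∈))
  ; bottom = ∈-descent⁺ ≤-refl (m≤n+m u k)
  ; closed = λ u≤j j≤y y∈ → ∈-descent⁺ u≤j (≤-trans j≤y (proj₂ (∈-descent⁻ y∈)))
  }

++-interval : ∀ {u v xs ys} → IntervalFrom u xs → IntervalFrom v ys → u ≤ v →
  (∀ {j} → u ≤ j → j < v → j ∈ xs) → IntervalFrom u (xs ++ ys)
++-interval {u} {v} {xs} {ys} Ix Iy u≤v below = record
  { lower  = All.++⁺ (lower Ix) (All.map (≤-trans u≤v) (lower Iy))
  ; bottom = ∈-++⁺ˡ (bottom Ix)
  ; closed = λ u≤j j≤y y∈ → closed′ u≤j j≤y (∈-++⁻ xs y∈)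
  }
  where
  closed′ : ∀ {j y} → u ≤ j → j ≤ y → y ∈ xs ⊎ y ∈ ys → j ∈ xs ++ ys
  closed′ u≤j j≤y (inj₁ y∈xs) = ∈-++⁺ˡ (closed Ix u≤j j≤y y∈xs)
  closed′ {j} u≤j j≤y (inj₂ y∈ys) with j <? v
  ... | yes j<v = ∈-++⁺ˡ (below u≤j j<v)
  ... | no j≮v = ∈-++⁺ʳ xs (closed Iy (≮⇒≥ j≮v) j≤y y∈ys)

interval⇒isCayley : ∀ {w} → IntervalFrom 1 w → IsCayley w
interval⇒isCayley {w} I = lower I , λ k 1≤k k≤max → closed I 1≤k k≤max (maxW-∈ w (≤-trans 1≤k k≤max))

isCayley⇒interval : ∀ {x xs} → IsCayley (x ∷ xs) → IntervalFrom 1 (x ∷ xs)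
isCayley⇒interval {x} {xs} (positive , covers) = record
  { lower  = positive
  ; bottom = closed′ ≤-refl (All.head positive) (here refl)
  ; closed = closed′
  }
  where
  closed′ : ∀ {j y} → 1 ≤ j → j ≤ y → y ∈ x ∷ xs → j ∈ x ∷ xs
  closed′ 1≤j j≤y y∈ = covers _ 1≤j (≤-trans j≤y (All.lookup (≤-maxW (x ∷ xs)) y∈))

decreasing-interval : ∀ {u h d} → StrictlyDecreasing (h ∷ d) → All (u ≤_) (h ∷ d) →
  (∀ {j} → u ≤ j → j ≤ h → j ∈ h ∷ d) → h ∷ d ≡ descent u (h ∸ u)
decreasing-interval {u} {h} {d} dec u≤ covers =
  decreasing-unique (h ∷ d) (descent u (h ∸ u)) dec (descent-decreasing u (h ∸ u)) sub sup
  where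
  top≡h : h ∸ u + u ≡ h
  top≡h = m∸n+n≡m (All.head u≤)
  sub : h ∷ d ⊆ descent u (h ∸ u)
  sub j∈ = ∈-descent⁺ (All.lookup u≤ j∈) (subst (_ ≤_) (sym top≡h) (decreasing-≤ dec j∈))
  sup : descent u (h ∸ u) ⊆ h ∷ d
  sup j∈ = uncurry (λ u≤j j≤top → covers u≤j (subst (_ ≤_) top≡h j≤top)) (∈-descent⁻ j∈)

-- decode u k gs starts with the factor descent u k = k + u, …, u.  The gap
-- extend enlarges the current factor; tie and climb close it and start a
-- new factor whose least entry is k + u, respectively k + u + 1.
data Gap : Set where
  extend tie climb : Gap

decode : ℕ → ℕ → List Gap → List ℕ
decode u k []            = descent u k
decode u k (extend ∷ gs) = decode u (suc k) gs
decode u k (tie ∷ gs)    = descent u k ++ decode (k + u) 0 gs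
decode u k (climb ∷ gs)  = descent u k ++ decode (suc (k + u)) 0 gs

length-decode : ∀ u k gs → length (decode u k gs) ≡ suc k + length gs
length-decode u k [] = trans (length-applyDownFrom (_+ u) (suc k)) (sym (+-identityʳ (suc k)))
length-decode u k (extend ∷ gs) = trans (length-decode u (suc k) gs) (sym (+-suc (suc k) (length gs)))
length-decode u k (tie ∷ gs) =
  trans (length-++ (descent u k)) (cong₂ _+_ (length-applyDownFrom (_+ u) (suc k)) (length-decode (k + u) 0 gs))
length-decode u k (climb ∷ gs) =
  trans (length-++ (descent u k)) (cong₂ _+_ (length-applyDownFrom (_+ u) (suc k)) (length-decode (suc (k + u)) 0 gs))

decode-extends : ∀ u j k gs → decode u j (replicate k extend ++ gs) ≡ decode u (j + k) gs
decode-extends u j zero gs = cong (λ i → decode u i gs) (sym (+-identityʳ j))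
decode-extends u j (suc k) gs = trans (decode-extends u (suc j) k gs) (cong (λ i → decode u i gs) (sym (+-suc j k)))

decode-interval : ∀ u k gs → IntervalFrom u (decode u k gs)
decode-interval u k [] = descent-interval u k
decode-interval u k (extend ∷ gs) = decode-interval u (suc k) gs
decode-interval u k (tie ∷ gs) =
  ++-interval (descent-interval u k) (decode-interval (k + u) 0 gs) (m≤n+m u k)
    (λ u≤j j<top → ∈-descent⁺ u≤j (<⇒≤ j<top))
decode-interval u k (climb ∷ gs) =
  ++-interval (descent-interval u k) (decode-interval (suc (k + u)) 0 gs) (m≤n⇒m≤1+n (m≤n+m u k))
    (λ u≤j j≤top → ∈-descent⁺ u≤j (≤-pred j≤top))

decode-head : ∀ u k gs → Connected _≤_ (just (k + u)) (head (decode u k gs))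
decode-head u k [] = just ≤-refl
decode-head u k (extend ∷ gs) = weaken (decode-head u (suc k) gs)
  where
  weaken : ∀ {m} → Connected _≤_ (just (suc k + u)) m → Connected _≤_ (just (k + u)) m
  weaken (just top<t) = just (<⇒≤ top<t)
  weaken just-nothing = just-nothing
decode-head u k (tie ∷ gs) = just ≤-refl
decode-head u k (climb ∷ gs) = just ≤-refl

SortedFrom : ℕ → List ℕ → Set
SortedFrom v o = WeaklyIncreasing o × head o ≡ just v

sortedFrom-descent-++ : ∀ u k {v rest} → k + u ≤ v → All (v ≤_) rest →
  SortedFrom v (tortoise rest) → SortedFrom u (tortoise (descent u k ++ rest))
sortedFrom-descent-++ u k {v} {rest} top≤v v≤rest (sorted , head≡v) =
  subst (SortedFrom u) (sym (tortoise-descent u k rest (All.map (≤-trans u≤v) v≤rest)))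
    (Linked.++⁺ (ascent-sorted u k) bridge sorted , refl)
  where
  u≤v : u ≤ v
  u≤v = ≤-trans (m≤n+m u k) top≤v
  bridge : Connected _≤_ (last (ascent u k)) (head (tortoise rest))
  bridge = subst₂ (Connected _≤_) (sym (last-applyUpTo (_+ u) k)) (sym head≡v) (just top≤v)

tortoise-decode : ∀ u k gs → SortedFrom u (tortoise (decode u k gs))
tortoise-decode u k [] = subst (SortedFrom u) (sym output) (ascent-sorted u k , refl)
  where
  output : tortoise (descent u k) ≡ ascent u k
  output = begin
    tortoise (descent u k)       ≡⟨ cong tortoise (sym (++-identityʳ (descent u k))) ⟩
    tortoise (descent u k ++ []) ≡⟨ tortoise-descent u k [] [] ⟩
    ascent u k ++ []             ≡⟨ ++-identityʳ (ascent u k) ⟩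
    ascent u k                   ∎
tortoise-decode u k (extend ∷ gs) = tortoise-decode u (suc k) gs
tortoise-decode u k (tie ∷ gs) =
  sortedFrom-descent-++ u k ≤-refl (lower (decode-interval (k + u) 0 gs)) (tortoise-decode (k + u) 0 gs)
tortoise-decode u k (climb ∷ gs) =
  sortedFrom-descent-++ u k (n≤1+n (k + u)) (lower (decode-interval (suc (k + u)) 0 gs))
    (tortoise-decode (suc (k + u)) 0 gs)

decode-bottom-injective : ∀ {a b k l gs hs} → decode a k gs ≡ decode b l hs → a ≡ b
decode-bottom-injective {a} {b} {k} {l} {gs} {hs} e = just-injective (begin
  just a                          ≡⟨ sym (proj₂ (tortoise-decode a k gs)) ⟩
  head (tortoise (decode a k gs)) ≡⟨ cong (head ∘ tortoise) e ⟩
  head (tortoise (decode b l hs)) ≡⟨ proj₂ (tortoise-decode b l hs) ⟩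
  just b                          ∎)

extend≢descent-++ : ∀ u k gs {ys} → decode u (suc k) gs ≢ descent u k ++ ys
extend≢descent-++ u k gs e =
  1+n≰n (drop-just (subst (λ w → Connected _≤_ (just (suc k + u)) (head w)) e (decode-head u (suc k) gs)))

decode-≡⇒length≡ : ∀ u k {gs hs} → decode u k gs ≡ decode u k hs → length gs ≡ length hs
decode-≡⇒length≡ u k {gs} {hs} e = +-cancelˡ-≡ (suc k) _ _ (begin
  suc k + length gs       ≡⟨ sym (length-decode u k gs) ⟩
  length (decode u k gs)  ≡⟨ cong length e ⟩
  length (decode u k hs)  ≡⟨ length-decode u k hs ⟩
  suc k + length hs       ∎)

decode-injective : ∀ u k {gs hs} → decode u k gs ≡ decode u k hs → gs ≡ hs
decode-injective u k {[]} {[]} _ = refl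
decode-injective u k {[]} {h ∷ hs} e with decode-≡⇒length≡ u k {[]} {h ∷ hs} e
... | ()
decode-injective u k {g ∷ gs} {[]} e with decode-≡⇒length≡ u k {g ∷ gs} {[]} e
... | ()
decode-injective u k {extend ∷ gs} {extend ∷ hs} e = cong (extend ∷_) (decode-injective u (suc k) e)
decode-injective u k {tie ∷ gs} {tie ∷ hs} e =
  cong (tie ∷_) (decode-injective (k + u) 0 (++-cancelˡ (descent u k) _ _ e))
decode-injective u k {climb ∷ gs} {climb ∷ hs} e =
  cong (climb ∷_) (decode-injective (suc (k + u)) 0 (++-cancelˡ (descent u k) _ _ e))
decode-injective u k {tie ∷ gs} {climb ∷ hs} e =
  contradiction (sym (decode-bottom-injective {gs = gs} {hs = hs} (++-cancelˡ (descent u k) _ _ e))) 1+n≢n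
decode-injective u k {climb ∷ gs} {tie ∷ hs} e =
  contradiction (decode-bottom-injective {gs = gs} {hs = hs} (++-cancelˡ (descent u k) _ _ e)) 1+n≢n
decode-injective u k {extend ∷ gs} {tie ∷ _} e = contradiction e (extend≢descent-++ u k gs)
decode-injective u k {extend ∷ gs} {climb ∷ _} e = contradiction e (extend≢descent-++ u k gs)
decode-injective u k {tie ∷ _} {extend ∷ hs} e = contradiction (sym e) (extend≢descent-++ u k hs)
decode-injective u k {climb ∷ _} {extend ∷ hs} e = contradiction (sym e) (extend≢descent-++ u k hs)

first-block : ∀ {u} w → IntervalFrom u w → WeaklyIncreasing (tortoise w) →
  ∃₂ λ k rest → w ≡ descent u k ++ rest × All (k + u ≤_) rest × WeaklyIncreasing (tortoise rest)
first-block [] I _ = contradiction (bottom I) λ ()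
first-block {u} (h ∷ xs) I sorted with tortoiseRun-firstPop h [] xs
... | d , rest , xs≡ , dec , output =
  h ∸ u , rest , trans w≡ (cong (_++ rest) block) ,
  subst (λ t → All (t ≤_) rest) (sym top≡h) h≤rest , linked-++⁻ʳ (d ʳ++ [ h ]) sorted′
  where
  sorted′ : WeaklyIncreasing ((d ʳ++ [ h ]) ++ tortoise rest)
  sorted′ = subst WeaklyIncreasing output sorted
  top≡h : h ∸ u + u ≡ h
  top≡h = m∸n+n≡m (All.head (lower I))
  -- h is the last entry of the first popped block and precedes all of rest in the output
  h≤rest : All (h ≤_) rest
  h≤rest = All.tabulate λ y∈ →
    allPairs-++⁻ (d ʳ++ [ h ]) (Linked.Linked⇒AllPairs ≤-trans sorted′)
      (reverseAcc⁺ [ h ] d (inj₁ (here refl))) (∈-resp-↭ (↭-sym (tortoiseRun-↭ [] rest)) y∈)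
  w≡ : h ∷ xs ≡ (h ∷ d) ++ rest
  w≡ = cong (h ∷_) xs≡
  covers : ∀ {j} → u ≤ j → j ≤ h → j ∈ h ∷ d
  covers {j} u≤j j≤h with ∈-++⁻ (h ∷ d) (subst (j ∈_) w≡ (closed I u≤j j≤h (here refl)))
  ... | inj₁ j∈block = j∈block
  ... | inj₂ j∈rest = here (≤-antisym j≤h (All.lookup h≤rest j∈rest))
  block : h ∷ d ≡ descent u (h ∸ u)
  block = decreasing-interval dec (All.++⁻ˡ (h ∷ d) (subst (All (u ≤_)) w≡ (lower I))) covers

closed-above-descent : ∀ {u k rest} → IntervalFrom u (descent u k ++ rest) →
  ∀ {j z} → k + u < j → j ≤ z → z ∈ rest → j ∈ rest
closed-above-descent {u} {k} I top<j j≤z z∈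
  with ∈-++⁻ (descent u k) (closed I (≤-trans (m≤n+m u k) (<⇒≤ top<j)) j≤z (∈-++⁺ʳ (descent u k) z∈))
... | inj₁ j∈descent = contradiction (proj₂ (∈-descent⁻ j∈descent)) (<⇒≱ top<j)
... | inj₂ j∈rest = j∈rest

next-interval : ∀ {t y r} → All (t ≤_) (y ∷ r) → (∀ {j z} → t < j → j ≤ z → z ∈ y ∷ r → j ∈ y ∷ r) →
  IntervalFrom t (y ∷ r) ⊎ IntervalFrom (suc t) (y ∷ r)
next-interval {t} {y} {r} t≤ closedAbove with t ∈? y ∷ r
... | yes t∈ = inj₁ record
  { lower  = t≤
  ; bottom = t∈
  ; closed = λ t≤j j≤z z∈ → [ (λ t<j → closedAbove t<j j≤z z∈) , (λ { refl → t∈ }) ]′ (m≤n⇒m<n∨m≡n t≤j)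
  }
... | no t∉ = inj₂ record
  { lower  = above
  ; bottom = closedAbove ≤-refl (All.head above) (here refl)
  ; closed = closedAbove
  }
  where
  above : All (suc t ≤_) (y ∷ r)
  above = All.tabulate λ z∈ → ≤∧≢⇒< (All.lookup t≤ z∈) λ { refl → t∉ z∈ }

_⊏_ : List ℕ → List ℕ → Set
xs ⊏ ys = length xs < length ys

⊏-wellFounded : WellFounded _⊏_
⊏-wellFounded = On.wellFounded length <-wellFounded

⊏-descent-++ : ∀ u k ys → ys ⊏ (descent u k ++ ys)
⊏-descent-++ u k ys = s≤s (length-++-≤ʳ ys {applyDownFrom (_+ u) k})

decode-complete : ∀ {u} w → Acc _⊏_ w → IntervalFrom u w → WeaklyIncreasing (tortoise w) →
  ∃ λ gs → w ≡ decode u 0 gs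
decode-complete {u} w (acc rec) I sorted with first-block w I sorted
... | k , [] , refl , _ , _ =
  replicate k extend , (begin
    descent u k ++ []                         ≡⟨ ++-identityʳ (descent u k) ⟩
    decode u k []                             ≡⟨ decode-extends u 0 k [] ⟨
    decode u 0 (replicate k extend ++ [])     ≡⟨ cong (decode u 0) (++-identityʳ (replicate k extend)) ⟩
    decode u 0 (replicate k extend)           ∎)
... | k , y ∷ r , refl , top≤rest , sorted′ with next-interval top≤rest (closed-above-descent I)
...   | inj₁ I′ with gs , rest≡ ← decode-complete (y ∷ r) (rec (⊏-descent-++ u k (y ∷ r))) I′ sorted′ =
  replicate k extend ++ tie ∷ gs ,
  trans (cong (descent u k ++_) rest≡) (sym (decode-extends u 0 k (tie ∷ gs)))
...   | inj₂ I′ with gs , rest≡ ← decode-complete (y ∷ r) (rec (⊏-descent-++ u k (y ∷ r))) I′ sorted′ =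
  replicate k extend ++ climb ∷ gs ,
  trans (cong (descent u k ++_) rest≡) (sym (decode-extends u 0 k (climb ∷ gs)))

allGaps : List Gap
allGaps = extend ∷ tie ∷ climb ∷ []

∈-allGaps : ∀ g → g ∈ allGaps
∈-allGaps extend = here refl
∈-allGaps tie = there (here refl)
∈-allGaps climb = there (there (here refl))

allGaps-unique : Unique allGaps
allGaps-unique = ((λ ()) ∷ (λ ()) ∷ []) ∷ ((λ ()) ∷ []) ∷ [] ∷ []

allGapLists : ℕ → List (List Gap)
allGapLists zero = [ [] ]
allGapLists (suc m) = cartesianProductWith _∷_ allGaps (allGapLists m)

length-allGapLists : ∀ m → length (allGapLists m) ≡ 3 ^ m
length-allGapLists zero = refl
length-allGapLists (suc m) =
  trans (length-cartesianProductWith _∷_ allGaps (allGapLists m)) (cong (3 *_) (length-allGapLists m))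

allGapLists-unique : ∀ m → Unique (allGapLists m)
allGapLists-unique zero = [] ∷ []
allGapLists-unique (suc m) = cartesianProductWith⁺ _∷_ ∷-injective allGaps-unique (allGapLists-unique m)

∈-allGapLists⁺ : ∀ gs → gs ∈ allGapLists (length gs)
∈-allGapLists⁺ [] = here refl
∈-allGapLists⁺ (g ∷ gs) = ∈-cartesianProductWith⁺ _∷_ (∈-allGaps g) (∈-allGapLists⁺ gs)

∈-allGapLists⁻ : ∀ {m gs} → gs ∈ allGapLists m → length gs ≡ m
∈-allGapLists⁻ {zero} (here refl) = refl
∈-allGapLists⁻ {zero} (there ())
∈-allGapLists⁻ {suc m} gs∈ with _ , _ , _ , gs′∈ , refl ← ∈-cartesianProductWith⁻ _∷_ allGaps (allGapLists m) gs∈ =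
  cong suc (∈-allGapLists⁻ gs′∈)

word : List Gap → List ℕ
word = decode 1 0

corollary3 : (m : ℕ) →
    Σ (List (List ℕ)) (λ L →
      Unique L × length L ≡ 3 ^ m ×
      (∀ w → (w ∈ L) ⇔ (length w ≡ suc m × IsCayley w × TortoiseSortable w)))
corollary3 m =
  map word (allGapLists m) ,
  map⁺ (decode-injective 1 0) (allGapLists-unique m) ,
  trans (length-map word (allGapLists m)) (length-allGapLists m) ,
  λ w → mk⇔ sound (complete w)
  where
  sound : ∀ {w} → w ∈ map word (allGapLists m) → length w ≡ suc m × IsCayley w × TortoiseSortable w
  sound w∈ with gs , gs∈ , refl ← ∈-map⁻ word w∈ =
    trans (length-decode 1 0 gs) (cong suc (∈-allGapLists⁻ gs∈)) ,
    interval⇒isCayley (decode-interval 1 0 gs) ,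
    proj₁ (tortoise-decode 1 0 gs)
  complete : ∀ w → length w ≡ suc m × IsCayley w × TortoiseSortable w → w ∈ map word (allGapLists m)
  complete [] (() , _)
  complete w@(_ ∷ _) (len , cayley , sortable)
    with gs , w≡ ← decode-complete w (⊏-wellFounded w) (isCayley⇒interval cayley) sortable =
    subst (_∈ map word (allGapLists m)) (sym w≡) (∈-map⁺ word (subst (λ n → gs ∈ allGapLists n) gaps≡ (∈-allGapLists⁺ gs)))
    where
    gaps≡ : length gs ≡ m
    gaps≡ = suc-injective (trans (sym (length-decode 1 0 gs)) (trans (cong length (sym w≡)) len))
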